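{- Let $p$ be a prime, $D=\{\mathbf{d}_1,\dots,\mathbf{d}_n\}\subset\mathbb{N}^r\setminus\{0\}$ finite nonempty, not contained in any coordinate hyperplane, $m\ge1$ and $U=(u_1,\dots,u_n)\in E_D(m)$. Let $1\le t\le m-1$ and for each $i$ let $u_i=p^tw_i+v_i$ with $0\le v_i<p^t$ be the euclidean division of $u_i$ by $p^t$. (i) $\sum_{i=1}^n\sigma_p(u_i)\mathbf{d}_i=(p-1)\sum_{k=0}^{m-1}\varphi(\delta_m^k(U))$. (ii) $\sum_{i=1}^nv_i\mathbf{d}_i=p^t\varphi(\delta_m^{ -t}(U))-\varphi(U)$ and $\sum_{i=1}^nw_i\mathbf{d}_i=p^{m-t}\varphi(U)-\varphi(\delta_m^{ -t}(U))$.
   Context: $\sigma_p(N)$ is the sum of base-$p$ digits of $N\ge0$. $E_D(m)$ is the set of $U=(u_1,\dots,u_n)\in\{0,\dots,p^m-1\}^n\setminus\{0\}$ with $\sum_iu_i\mathbf{d}_i\equiv0\pmod{p^m-1}$ coordinatewise and $\sum_iu_id_{ij}>0$ for every coordinate $j$. The shift $\delta_m$ on $\{0,\dots,p^m-1\}$ sends $0\le N\le p^m-2$ to the residue of $pN$ modulo $p^m-1$ and fixes $p^m-1$; it is extended coordinatewise to $n$-tuples, is a bijection of $E_D(m)$ with $\delta_m^m=\mathrm{Id}$, and $\delta_m^{ -t}$ denotes its inverse power. $\varphi:E_D(m)\to\mathbb{N}^r$, $\varphi(U)=\frac{1}{p^m-1}\sum_iu_i\mathbf{d}_i$. -}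

module Defs where

open import Data.Nat using (ℕ; zero; suc; _+_; _*_; _∸_; _^_; _<_; _/_; _%_)
open import Data.Nat.Divisibility using (_∣_)
open import Data.Fin using (Fin)
open import Data.List using (List; tabulate; upTo; map)
open import Data.Nat.ListAction using (sum)
open import Data.Product using (∃; _×_)
open import Relation.Nullary using (¬_; yes; no)
open import Relation.Binary.PropositionalEquality using (_≡_)
open import Data.Nat using (_≟_)
open import Function using (_∘_)

∑ : {n : ℕ} → (Fin n → ℕ) → ℕ
∑ f = sum (tabulate f)

∑< : ℕ → (ℕ → ℕ) → ℕ
∑< m f = sum (map f (upTo m))

-- Total division / remainder (value irrelevant when the divisor is 0;
-- only used with nonzero divisors).
_div_ : ℕ → ℕ → ℕ
a div zero = 0
a div suc b = a / suc b

_mod_ : ℕ → ℕ → ℕ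
a mod zero = a
a mod suc b = a % suc b

-- σ_p(N): sum of base-p digits of N (meaningful for p ≥ 2).
-- Fuel-driven recursion; fuel N suffices since N / p < N for p ≥ 2, N > 0.
digitSumAux : ℕ → ℕ → ℕ → ℕ
digitSumAux p zero    N = 0
digitSumAux p (suc f) zero = 0
digitSumAux p (suc f) (suc N) = (suc N mod p) + digitSumAux p f (suc N div p)

σ : ℕ → ℕ → ℕ
σ p N = digitSumAux p N N

δ₀ : ℕ → ℕ → ℕ → ℕ
δ₀ p m N with N ≟ (p ^ m ∸ 1)
... | yes _ = N
... | no  _ = (p * N) mod (p ^ m ∸ 1)

δ : ℕ → ℕ → {n : ℕ} → (Fin n → ℕ) → (Fin n → ℕ)
δ p m U i = δ₀ p m (U i)

iter : {A : Set} → ℕ → (A → A) → A → A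
iter zero    f x = x
iter (suc k) f x = f (iter k f x)

-- Coordinate j of ∑_i u_i d_i, where D i j is coordinate j of d_i.
lin : {n r : ℕ} → (Fin n → Fin r → ℕ) → (Fin n → ℕ) → Fin r → ℕ
lin D U j = ∑ (λ i → U i * D i j)

record InE (p : ℕ) {n r : ℕ} (D : Fin n → Fin r → ℕ) (m : ℕ) (U : Fin n → ℕ) : Set where
  field
    bounded  : ∀ i → U i < p ^ m
    nonzero  : ¬ (∀ i → U i ≡ 0)
    divisible : ∀ j → (p ^ m ∸ 1) ∣ lin D U j
    positive : ∀ j → 0 < lin D U j

φ : (p : ℕ) {n r : ℕ} (D : Fin n → Fin r → ℕ) (m : ℕ) → (Fin n → ℕ) → Fin r → ℕ
φ p D m U j = lin D U j div (p ^ m ∸ 1)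

module Submission where

-- Put M = p^m − 1.  A number x < p^m is a string of m base-p digits, and
-- the shift δ_m rotates this string by one place: writing x = p^(m−1)·a + b
-- with a < p the top digit, δ_m(x) = p·b + a, hence
--     p·x = M·a + δ_m(x).                                          (step)
-- Iterating, δ_m^s rotates by s places, so for u = p^t·w + v (v < p^t)
--     p^t·δ_m^(m−t)(u) = M·v + u   and   p^(m−t)·u = M·w + δ_m^(m−t)(u),
-- and δ_m^m(u) = u.  Summing (step) along the orbit x_s = δ_m^s(u)
-- telescopes to (p−1)·Σ_{s<m} δ_m^s(u) = M·Σ_s a_s, where the top digits
-- a_s of the x_s run through all digits of u, i.e. Σ_s a_s = σ_p(u).
-- All these identities are linear in u, so applying u ↦ Σ_i u_i·d_i and
-- dividing by M yields (i) and (ii).  Note that δ_m^(−t) = δ_m^(m−t).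

open import Defs
open import Data.Nat using (ℕ; zero; suc; _+_; _*_; _∸_; _^_; _<_; _≤_; z≤n; s≤s; _/_; _%_; NonZero; _≟_; >-nonZero)
open import Data.Nat.Properties
open import Data.Nat.DivMod using (m≡m%n+[m/n]*n; m%n<n; m<n*o⇒m/o<n; m/n<m; m/n*n≡m; [m+kn]%n≡m%n; m<n⇒m%n≡m; m*n/n≡m; m<n⇒m/n≡0; +-distrib-/-∣ˡ)
open import Data.Nat.Divisibility using (_∣_; ∣m+n∣m⇒∣n; ∣n⇒∣m*n; m∣m*n)
open import Data.Nat.Tactic.RingSolver using (solve-∀)
open import Data.Nat.Primality using (Prime; ¬prime[0]; ¬prime[1])
open import Data.Fin using (Fin) renaming (zero to fz; suc to fs)
open import Data.List using ([_]; _++_; map; upTo)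
open import Data.List.Properties using (applyUpTo-∷ʳ; map-++)
open import Data.Nat.ListAction using (sum)
open import Data.Nat.ListAction.Properties using (sum-++)
open import Data.Integer using (+_; _-_; _⊖_)
open import Data.Integer.Properties using ([+m]-[+n]≡m⊖n; ⊖-≥)
open import Data.Product using (∃; _×_; _,_; proj₁; proj₂)
open import Data.Empty using (⊥-elim)
open import Relation.Nullary using (¬_; Dec; yes; no)
open import Relation.Binary.PropositionalEquality using (_≡_; refl; sym; trans; cong; cong₂; subst; module ≡-Reasoning)
open import Function.Definitions using (Injective)

euclid : ∀ x Q .{{_ : NonZero Q}} → x ≡ Q * (x / Q) + x % Q
euclid x Q = trans (m≡m%n+[m/n]*n x Q)
                   (trans (+-comm (x % Q) _) (cong (_+ x % Q) (*-comm (x / Q) Q)))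

quotient-of-digits : ∀ {Q} a {b} .{{_ : NonZero Q}} → b < Q → (Q * a + b) / Q ≡ a
quotient-of-digits {Q} a {b} b<Q = begin
  (Q * a + b) / Q    ≡⟨ +-distrib-/-∣ˡ b (m∣m*n a) ⟩
  Q * a / Q + b / Q  ≡⟨ cong₂ _+_ (trans (cong (_/ Q) (*-comm Q a)) (m*n/n≡m a Q)) (m<n⇒m/n≡0 b<Q) ⟩
  a + 0              ≡⟨ +-identityʳ a ⟩
  a                  ∎
  where open ≡-Reasoning

mod-multiple : ∀ {Q} a {x} .{{_ : NonZero Q}} → x < Q → (Q * a + x) % Q ≡ x
mod-multiple {Q} a {x} x<Q = begin
  (Q * a + x) % Q  ≡⟨ cong (_% Q) (trans (+-comm (Q * a) x) (cong (_+_ x) (*-comm Q a))) ⟩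
  (x + a * Q) % Q  ≡⟨ [m+kn]%n≡m%n x a Q ⟩
  x % Q            ≡⟨ m<n⇒m%n≡m x<Q ⟩
  x                ∎
  where open ≡-Reasoning

div≡/ : ∀ x Q .{{_ : NonZero Q}} → x div Q ≡ x / Q
div≡/ x (suc Q) = refl

mod≡% : ∀ x Q .{{_ : NonZero Q}} → x mod Q ≡ x % Q
mod≡% x (suc Q) = refl

div-exact : ∀ {L Q} .{{_ : NonZero Q}} → Q ∣ L → L div Q * Q ≡ L
div-exact {L} {Q} Q∣L = trans (cong (_* Q) (div≡/ L Q)) (m/n*n≡m Q∣L)

digits-bound : ∀ {A B a b} → a < A → b < B → suc (B * a + b) ≤ A * B
digits-bound {A} {B} {a} {b} a<A b<B = begin
  suc (B * a + b)  ≡⟨ sym (+-suc (B * a) b) ⟩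
  B * a + suc b    ≤⟨ +-monoʳ-≤ (B * a) b<B ⟩
  B * a + B        ≡⟨ trans (+-comm (B * a) B) (sym (*-suc B a)) ⟩
  B * suc a        ≤⟨ *-monoʳ-≤ B a<A ⟩
  B * A            ≡⟨ *-comm B A ⟩
  A * B            ∎
  where open ≤-Reasoning

digits-max : ∀ {A B a b} → a < A → b < B → suc (B * a + b) ≡ A * B → suc a ≡ A × suc b ≡ B
digits-max {A} {B} {a} {b} a<A b<B e = top , bottom
  where
  open ≡-Reasoning
  e′ : B * a + suc b ≡ A * B
  e′ = trans (+-suc (B * a) b) e
  below : B * suc a ≤ A * B
  below = ≤-trans (*-monoʳ-≤ B a<A) (≤-reflexive (*-comm B A))
  bottom : suc b ≡ B
  bottom = ≤-antisym b<B (+-cancelˡ-≤ (B * a) B (suc b)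
             (≤-trans (≤-reflexive (trans (+-comm (B * a) B) (sym (*-suc B a)))) (≤-trans below (≤-reflexive (sym e′)))))
  top : suc a ≡ A
  top = *-cancelʳ-≡ (suc a) A B ⦃ >-nonZero (≤-trans (s≤s z≤n) b<B) ⦄ (begin
    suc a * B      ≡⟨ *-comm (suc a) B ⟩
    B * suc a      ≡⟨ *-suc B a ⟩
    B + B * a      ≡⟨ +-comm B (B * a) ⟩
    B * a + B      ≡⟨ cong (_+_ (B * a)) (sym bottom) ⟩
    B * a + suc b  ≡⟨ e′ ⟩
    A * B          ∎)

swap-maximal : ∀ {A B a b} → suc a ≡ A → suc b ≡ B → B * a + b ≡ A * b + a
swap-maximal {a = a} {b} refl refl = identity a b
  where
  identity : ∀ a b → suc b * a + b ≡ suc a * b + a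
  identity = solve-∀

-- Multiplying the two-digit number Q·a + b by P moves its top digit a to the
-- bottom, up to a multiple of M = P·Q − 1: the arithmetic behind the shift.
digit-rotation : ∀ P Q a b M → suc M ≡ P * Q → P * (Q * a + b) ≡ M * a + (P * b + a)
digit-rotation P Q a b M e = begin
  P * (Q * a + b)      ≡⟨ expand P Q a b ⟩
  P * Q * a + P * b    ≡⟨ cong (λ z → z * a + P * b) (sym e) ⟩
  suc M * a + P * b    ≡⟨ regroup M a P b ⟩
  M * a + (P * b + a)  ∎
  where
  open ≡-Reasoning
  expand : ∀ P Q a b → P * (Q * a + b) ≡ P * Q * a + P * b
  expand = solve-∀
  regroup : ∀ M a P b → suc M * a + P * b ≡ M * a + (P * b + a)
  regroup = solve-∀

difference-formula : ∀ c a b V M .{{_ : NonZero M}} → c * (a * M) ≡ M * V + b * M → + V ≡ + (c * a) - + b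
difference-formula c a b V M e = begin
  + V                  ≡⟨ cong +_ (sym (m+n∸n≡m V b)) ⟩
  + (V + b ∸ b)        ≡⟨ sym (⊖-≥ (m≤n+m b V)) ⟩
  (V + b) ⊖ b         ≡⟨ sym ([+m]-[+n]≡m⊖n (V + b) b) ⟩
  + (V + b) - + b      ≡⟨ cong (λ z → + z - + b) (sym ca≡V+b) ⟩
  + (c * a) - + b      ∎
  where
  open ≡-Reasoning
  ca≡V+b : c * a ≡ V + b
  ca≡V+b = *-cancelʳ-≡ (c * a) (V + b) M (begin
    c * a * M          ≡⟨ *-assoc c a M ⟩
    c * (a * M)        ≡⟨ e ⟩
    M * V + b * M      ≡⟨ cong (_+ b * M) (*-comm M V) ⟩
    V * M + b * M      ≡⟨ sym (*-distribʳ-+ M V b) ⟩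
    (V + b) * M        ∎)

∑<-snoc : ∀ s f → ∑< (suc s) f ≡ ∑< s f + f s
∑<-snoc s f = begin
  sum (map f (upTo (suc s)))           ≡⟨ cong (λ l → sum (map f l)) (sym (applyUpTo-∷ʳ (λ x → x) s)) ⟩
  sum (map f (upTo s ++ [ s ]))        ≡⟨ cong sum (map-++ f (upTo s) [ s ]) ⟩
  sum (map f (upTo s) ++ [ f s ])      ≡⟨ sum-++ (map f (upTo s)) [ f s ] ⟩
  ∑< s f + (f s + 0)                   ≡⟨ cong (_+_ (∑< s f)) (+-identityʳ (f s)) ⟩
  ∑< s f + f s                         ∎
  where open ≡-Reasoning

∑<-cong : ∀ s {f g : ℕ → ℕ} → (∀ k → f k ≡ g k) → ∑< s f ≡ ∑< s g
∑<-cong zero    h = refl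
∑<-cong (suc s) {f} {g} h =
  trans (∑<-snoc s f) (trans (cong₂ _+_ (∑<-cong s h) (h s)) (sym (∑<-snoc s g)))

∑<-*ʳ : ∀ s f d → ∑< s (λ k → f k * d) ≡ ∑< s f * d
∑<-*ʳ zero    f d = refl
∑<-*ʳ (suc s) f d = begin
  ∑< (suc s) (λ k → f k * d)    ≡⟨ ∑<-snoc s (λ k → f k * d) ⟩
  ∑< s (λ k → f k * d) + f s * d ≡⟨ cong (_+ f s * d) (∑<-*ʳ s f d) ⟩
  ∑< s f * d + f s * d          ≡⟨ sym (*-distribʳ-+ d (∑< s f) (f s)) ⟩
  (∑< s f + f s) * d            ≡⟨ cong (_* d) (sym (∑<-snoc s f)) ⟩
  ∑< (suc s) f * d              ∎
  where open ≡-Reasoning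

telescope : ∀ c M (x y : ℕ → ℕ) → (∀ k → c * x k ≡ M * y k + x (suc k)) →
            ∀ s → c * ∑< s x + x 0 ≡ ∑< s x + x s + M * ∑< s y
telescope c M x y step zero = base c M (x 0)
  where
  base : ∀ c M x₀ → c * 0 + x₀ ≡ 0 + x₀ + M * 0
  base = solve-∀
telescope c M x y step (suc s) = begin
  c * ∑< (suc s) x + x 0                          ≡⟨ cong (λ z → c * z + x 0) (∑<-snoc s x) ⟩
  c * (X + x s) + x 0                             ≡⟨ split c X (x s) (x 0) ⟩
  (c * X + x 0) + c * x s                         ≡⟨ cong₂ _+_ (telescope c M x y step s) (step s) ⟩
  (X + x s + M * Y) + (M * y s + x (suc s))       ≡⟨ collect X (x s) M Y (y s) (x (suc s)) ⟩
  (X + x s) + x (suc s) + M * (Y + y s)           ≡⟨ cong₂ (λ A B → A + x (suc s) + M * B) (sym (∑<-snoc s x)) (sym (∑<-snoc s y)) ⟩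
  ∑< (suc s) x + x (suc s) + M * ∑< (suc s) y     ∎
  where
  open ≡-Reasoning
  X = ∑< s x
  Y = ∑< s y
  split : ∀ c X xs x₀ → c * (X + xs) + x₀ ≡ (c * X + x₀) + c * xs
  split = solve-∀
  collect : ∀ X xs M Y ys xs′ → (X + xs + M * Y) + (M * ys + xs′) ≡ (X + xs) + xs′ + M * (Y + ys)
  collect = solve-∀

lin-cong : ∀ {n r} (D : Fin n → Fin r → ℕ) j {x y : Fin n → ℕ} → (∀ i → x i ≡ y i) → lin D x j ≡ lin D y j
lin-cong {zero}  D j h = refl
lin-cong {suc n} D j h = cong₂ _+_ (cong (_* D fz j) (h fz)) (lin-cong (λ i → D (fs i)) j (λ i → h (fs i)))

lin-zero : ∀ {n r} (D : Fin n → Fin r → ℕ) j → lin D (λ _ → 0) j ≡ 0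
lin-zero {zero}  D j = refl
lin-zero {suc n} D j = lin-zero (λ i → D (fs i)) j

lin-+ : ∀ {n r} (D : Fin n → Fin r → ℕ) j (x y : Fin n → ℕ) →
        lin D (λ i → x i + y i) j ≡ lin D x j + lin D y j
lin-+ {zero}  D j x y = refl
lin-+ {suc n} D j x y = begin
  (x fz + y fz) * D fz j + lin D′ (λ i → x′ i + y′ i) j  ≡⟨ cong (_+_ ((x fz + y fz) * D fz j)) (lin-+ D′ j x′ y′) ⟩
  (x fz + y fz) * D fz j + (lin D′ x′ j + lin D′ y′ j)    ≡⟨ interchange (x fz) (y fz) (D fz j) (lin D′ x′ j) (lin D′ y′ j) ⟩
  (x fz * D fz j + lin D′ x′ j) + (y fz * D fz j + lin D′ y′ j) ∎
  where
  open ≡-Reasoning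
  D′ = λ i → D (fs i)
  x′ = λ i → x (fs i)
  y′ = λ i → y (fs i)
  interchange : ∀ a b d X Y → (a + b) * d + (X + Y) ≡ (a * d + X) + (b * d + Y)
  interchange = solve-∀

lin-scale : ∀ {n r} (D : Fin n → Fin r → ℕ) j c (x : Fin n → ℕ) → lin D (λ i → c * x i) j ≡ c * lin D x j
lin-scale {zero}  D j c x = sym (*-zeroʳ c)
lin-scale {suc n} D j c x = begin
  c * x fz * D fz j + lin D′ (λ i → c * x′ i) j  ≡⟨ cong (_+_ (c * x fz * D fz j)) (lin-scale D′ j c x′) ⟩
  c * x fz * D fz j + c * lin D′ x′ j            ≡⟨ factor c (x fz) (D fz j) (lin D′ x′ j) ⟩
  c * (x fz * D fz j + lin D′ x′ j)              ∎
  where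
  open ≡-Reasoning
  D′ = λ i → D (fs i)
  x′ = λ i → x (fs i)
  factor : ∀ c a d X → c * a * d + c * X ≡ c * (a * d + X)
  factor = solve-∀

lin-affine : ∀ {n r} (D : Fin n → Fin r → ℕ) j c M (x y z : Fin n → ℕ) →
             (∀ i → c * x i ≡ M * y i + z i) → c * lin D x j ≡ M * lin D y j + lin D z j
lin-affine D j c M x y z h = begin
  c * lin D x j                        ≡⟨ sym (lin-scale D j c x) ⟩
  lin D (λ i → c * x i) j              ≡⟨ lin-cong D j h ⟩
  lin D (λ i → M * y i + z i) j        ≡⟨ lin-+ D j (λ i → M * y i) z ⟩
  lin D (λ i → M * y i) j + lin D z j  ≡⟨ cong (_+ lin D z j) (lin-scale D j M y) ⟩
  M * lin D y j + lin D z j            ∎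
  where open ≡-Reasoning

lin-∑< : ∀ {n r} (D : Fin n → Fin r → ℕ) j (F : ℕ → Fin n → ℕ) s →
         lin D (λ i → ∑< s (λ l → F l i)) j ≡ ∑< s (λ l → lin D (F l) j)
lin-∑< D j F zero    = lin-zero D j
lin-∑< D j F (suc s) = begin
  lin D (λ i → ∑< (suc s) (λ l → F l i)) j          ≡⟨ lin-cong D j (λ i → ∑<-snoc s (λ l → F l i)) ⟩
  lin D (λ i → ∑< s (λ l → F l i) + F s i) j        ≡⟨ lin-+ D j (λ i → ∑< s (λ l → F l i)) (F s) ⟩
  lin D (λ i → ∑< s (λ l → F l i)) j + lin D (F s) j ≡⟨ cong (_+ lin D (F s) j) (lin-∑< D j F s) ⟩
  ∑< s (λ l → lin D (F l) j) + lin D (F s) j        ≡⟨ sym (∑<-snoc s (λ l → lin D (F l) j)) ⟩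
  ∑< (suc s) (λ l → lin D (F l) j)                  ∎
  where open ≡-Reasoning

δ₀-fixed : ∀ p m N → N ≡ p ^ m ∸ 1 → δ₀ p m N ≡ N
δ₀-fixed p m N e with N ≟ p ^ m ∸ 1
... | yes _ = refl
... | no ne = ⊥-elim (ne e)

δ₀-moved : ∀ p m N → ¬ (N ≡ p ^ m ∸ 1) → δ₀ p m N ≡ (p * N) mod (p ^ m ∸ 1)
δ₀-moved p m N ne with N ≟ p ^ m ∸ 1
... | yes e = ⊥-elim (ne e)
... | no _  = refl

module Shift (p′ k : ℕ) where

  p m M : ℕ
  p = suc (suc p′)
  m = suc k
  M = p ^ m ∸ 1

  instance
    p^k≢0 : NonZero (p ^ k)
    p^k≢0 = m^n≢0 p k

  suc-M : suc M ≡ p ^ m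
  suc-M = trans (+-comm 1 M) (m∸n+n≡m (m^n>0 p m))

  M-pos : 0 < M
  M-pos = m<n⇒0<n∸m (^-monoʳ-< p (s≤s (s≤s z≤n)) (s≤s (z≤n {k})))

  -- Passed explicitly: as an instance it would overlap with p^k≢0.
  M≢0 : NonZero M
  M≢0 = >-nonZero M-pos

  shift : ℕ → ℕ
  shift = δ₀ p m

  lead : ℕ → ℕ
  lead x = x / p ^ k

  shift-digits : ∀ {a b} → a < p → b < p ^ k → shift (p ^ k * a + b) ≡ p * b + a
  shift-digits {a} {b} a<p b<q = by-cases (N ≟ M)
    where
    open ≡-Reasoning
    N x : ℕ
    N = p ^ k * a + b
    x = p * b + a
    -- N = M exactly when both digits are maximal, and then x = N.
    N-maximal : N ≡ M → N ≡ x
    N-maximal N≡M = swap-maximal (proj₁ maximal) (proj₂ maximal)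
      where maximal = digits-max a<p b<q (trans (cong suc N≡M) suc-M)
    x-maximal : x ≡ M → N ≡ x
    x-maximal x≡M = sym (swap-maximal (proj₁ maximal) (proj₂ maximal))
      where maximal = digits-max b<q a<p (trans (cong suc x≡M) (trans suc-M (*-comm p (p ^ k))))
    x<M : ¬ (N ≡ M) → x < M
    x<M N≢M = ≤∧≢⇒< (≤-pred (≤-trans (digits-bound b<q a<p) (≤-reflexive (trans (*-comm (p ^ k) p) (sym suc-M)))))
                    (λ x≡M → N≢M (trans (x-maximal x≡M) x≡M))
    by-cases : Dec (N ≡ M) → shift N ≡ x
    by-cases (yes N≡M) = trans (δ₀-fixed p m N N≡M) (N-maximal N≡M)
    by-cases (no N≢M)  = begin
      shift N              ≡⟨ δ₀-moved p m N N≢M ⟩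
      (p * N) mod M        ≡⟨ cong (_mod M) (digit-rotation p (p ^ k) a b M suc-M) ⟩
      (M * a + x) mod M    ≡⟨ mod≡% (M * a + x) M ⦃ M≢0 ⦄ ⟩
      _%_ (M * a + x) M ⦃ M≢0 ⦄ ≡⟨ mod-multiple a ⦃ M≢0 ⦄ (x<M N≢M) ⟩
      x                    ∎

  lead<p : ∀ {x} → x < p ^ m → lead x < p
  lead<p x< = m<n*o⇒m/o<n x<

  shift-top : ∀ {x} → x < p ^ m → shift x ≡ p * (x % p ^ k) + lead x
  shift-top {x} x< = trans (cong shift (euclid x (p ^ k))) (shift-digits (lead<p x<) (m%n<n x (p ^ k)))

  shift-step : ∀ {x} → x < p ^ m → p * x ≡ M * lead x + shift x
  shift-step {x} x< = begin
    p * x                                    ≡⟨ cong (p *_) (euclid x (p ^ k)) ⟩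
    p * (p ^ k * lead x + x % p ^ k)         ≡⟨ digit-rotation p (p ^ k) (lead x) (x % p ^ k) M suc-M ⟩
    M * lead x + (p * (x % p ^ k) + lead x)  ≡⟨ cong (_+_ (M * lead x)) (sym (shift-top x<)) ⟩
    M * lead x + shift x                     ∎
    where open ≡-Reasoning

  shift-bound : ∀ {x} → x < p ^ m → shift x < p ^ m
  shift-bound {x} x< = begin-strict
    shift x                   ≡⟨ shift-top x< ⟩
    p * (x % p ^ k) + lead x  <⟨ digits-bound (m%n<n x (p ^ k)) (lead<p x<) ⟩
    p ^ k * p                 ≡⟨ *-comm (p ^ k) p ⟩
    p ^ m                     ∎
    where open ≤-Reasoning

  iter-bound : ∀ s {x} → x < p ^ m → iter s shift x < p ^ m
  iter-bound zero    x< = x<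
  iter-bound (suc s) x< = shift-bound (iter-bound s x<)

  regroup : ∀ r a b → p ^ r * a + b ≡ p ^ suc r * (a / p) + (p ^ r * (a % p) + b)
  regroup r a b = trans (cong (λ z → p ^ r * z + b) (m≡m%n+[m/n]*n a p)) (identity p (p ^ r) (a % p) (a / p) b)
    where
    identity : ∀ P q a₀ a₁ b → q * (a₀ + a₁ * P) + b ≡ P * q * a₁ + (q * a₀ + b)
    identity = solve-∀

  upper< : ∀ s {a} → a < p ^ suc s → a / p < p ^ s
  upper< s {a} a< = m<n*o⇒m/o<n (subst (a <_) (*-comm p (p ^ s)) a<)

  lower< : ∀ r a {b} → b < p ^ r → p ^ r * (a % p) + b < p ^ suc r
  lower< r a b< = digits-bound (m%n<n a p) b<

  p^-split : ∀ s r → s + r ≡ k → p ^ s * p ^ r ≡ p ^ k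
  p^-split s r e = trans (sym (^-distribˡ-+-* p s r)) (cong (p ^_) e)

  rest< : ∀ s r {a b} → suc s + r ≡ m → a < p ^ suc s → b < p ^ r → p ^ s * b + a / p < p ^ k
  rest< s r e a< b< =
    ≤-trans (digits-bound b< (upper< s a<)) (≤-reflexive (trans (*-comm (p ^ r) (p ^ s)) (p^-split s r (suc-injective e))))

  rotate : ∀ s r {u a b} → s + r ≡ m → u ≡ p ^ r * a + b → a < p ^ s → b < p ^ r →
           iter s shift u ≡ p ^ s * b + a

  rotate-but-one : ∀ s r {u a b} → suc s + r ≡ m → u ≡ p ^ r * a + b → a < p ^ suc s → b < p ^ r →
                   iter s shift u ≡ p ^ k * (a % p) + (p ^ s * b + a / p)

  rotate zero r {b = b} e eu (s≤s z≤n) b< = trans eu (identity (p ^ r) b)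
    where
    identity : ∀ q b → q * 0 + b ≡ 1 * b + 0
    identity = solve-∀
  rotate (suc s) r {u} {a} {b} e eu a< b< = begin
    shift (iter s shift u)                ≡⟨ cong shift (rotate-but-one s r e eu a< b<) ⟩
    shift (p ^ k * (a % p) + y)           ≡⟨ shift-digits (m%n<n a p) (rest< s r e a< b<) ⟩
    p * y + a % p                         ≡⟨ identity p (p ^ s) b (a / p) (a % p) ⟩
    p ^ suc s * b + (a % p + a / p * p)   ≡⟨ cong (_+_ (p ^ suc s * b)) (sym (m≡m%n+[m/n]*n a p)) ⟩
    p ^ suc s * b + a                     ∎
    where
    open ≡-Reasoning
    y = p ^ s * b + a / p
    identity : ∀ P q b a₁ a₀ → P * (q * b + a₁) + a₀ ≡ P * q * b + (a₀ + a₁ * P)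
    identity = solve-∀

  rotate-but-one s r {u} {a} {b} e eu a< b< = begin
    iter s shift u                                  ≡⟨ rotate s (suc r) (trans (+-suc s r) e) (trans eu (regroup r a b)) (upper< s a<) (lower< r a b<) ⟩
    p ^ s * (p ^ r * (a % p) + b) + a / p           ≡⟨ identity (p ^ s) (p ^ r) (a % p) b (a / p) ⟩
    p ^ s * p ^ r * (a % p) + (p ^ s * b + a / p)   ≡⟨ cong (λ z → z * (a % p) + (p ^ s * b + a / p)) (p^-split s r (suc-injective e)) ⟩
    p ^ k * (a % p) + (p ^ s * b + a / p)           ∎
    where
    open ≡-Reasoning
    identity : ∀ X Y a₀ b a₁ → X * (Y * a₀ + b) + a₁ ≡ X * Y * a₀ + (X * b + a₁)
    identity = solve-∀

  digitSum : ℕ → ℕ → ℕ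
  digitSum zero    a = 0
  digitSum (suc s) a = a % p + digitSum s (a / p)

  leading-digits : ∀ s r {u a b} → s + r ≡ m → u ≡ p ^ r * a + b → a < p ^ s → b < p ^ r →
                   ∑< s (λ j → lead (iter j shift u)) ≡ digitSum s a
  leading-digits zero    r e eu a< b< = refl
  leading-digits (suc s) r {u} {a} {b} e eu a< b< = begin
    ∑< (suc s) (λ j → lead (iter j shift u))                  ≡⟨ ∑<-snoc s (λ j → lead (iter j shift u)) ⟩
    ∑< s (λ j → lead (iter j shift u)) + lead (iter s shift u) ≡⟨ cong₂ _+_ lower-digits top-digit ⟩
    digitSum s (a / p) + a % p                                ≡⟨ +-comm (digitSum s (a / p)) (a % p) ⟩
    digitSum (suc s) a                                        ∎
    where
    open ≡-Reasoning
    lower-digits : ∑< s (λ j → lead (iter j shift u)) ≡ digitSum s (a / p)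
    lower-digits = leading-digits s (suc r) (trans (+-suc s r) e) (trans eu (regroup r a b)) (upper< s a<) (lower< r a b<)
    top-digit : lead (iter s shift u) ≡ a % p
    top-digit = trans (cong lead (rotate-but-one s r e eu a< b<)) (quotient-of-digits (a % p) (rest< s r e a< b<))

  digitSum-zero : ∀ s → digitSum s 0 ≡ 0
  digitSum-zero zero    = refl
  digitSum-zero (suc s) = digitSum-zero s

  digitSumAux≡digitSum : ∀ f s {N} → N < p ^ s → N ≤ f → digitSumAux p f N ≡ digitSum s N
  digitSumAux≡digitSum zero    s         N< z≤n = sym (digitSum-zero s)
  digitSumAux≡digitSum (suc f) s {zero}  N< N≤f = sym (digitSum-zero s)
  digitSumAux≡digitSum (suc f) zero    {suc N} (s≤s ()) N≤f
  digitSumAux≡digitSum (suc f) (suc s) {suc N} N< (s≤s N≤f) =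
    cong (_+_ (suc N % p)) (digitSumAux≡digitSum f s (upper< s N<) (≤-trans (≤-pred (m/n<m (suc N) p (s≤s (s≤s z≤n)))) N≤f))

  σ≡digitSum : ∀ s {N} → N < p ^ s → σ p N ≡ digitSum s N
  σ≡digitSum s {N} N< = digitSumAux≡digitSum N s N< ≤-refl

  trivial-split : ∀ u → u ≡ p ^ 0 * u + 0
  trivial-split u = sym (trans (+-identityʳ (1 * u)) (*-identityˡ u))

  orbit-closes : ∀ {u} → u < p ^ m → iter m shift u ≡ u
  orbit-closes {u} u< = trans (rotate m 0 (+-identityʳ m) (trivial-split u) u< (s≤s z≤n))
                              (cong (_+ u) (*-zeroʳ (p ^ m)))

  orbit-digits : ∀ {u} → u < p ^ m → ∑< m (λ j → lead (iter j shift u)) ≡ σ p u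
  orbit-digits {u} u< = trans (leading-digits m 0 (+-identityʳ m) (trivial-split u) u< (s≤s z≤n))
                              (sym (σ≡digitSum m u<))

  orbit-sum : ∀ {u} → u < p ^ m → (p ∸ 1) * ∑< m (λ j → iter j shift u) ≡ M * σ p u
  orbit-sum {u} u< = +-cancelˡ-≡ (S + u) ((p ∸ 1) * S) (M * σ p u) (begin
    (S + u) + (p ∸ 1) * S                 ≡⟨ rearrange S u ((p ∸ 1) * S) ⟩
    p * S + u                             ≡⟨ telescope p M x (λ j → lead (x j)) (λ j → shift-step (iter-bound j u<)) m ⟩
    S + x m + M * ∑< m (λ j → lead (x j)) ≡⟨ cong₂ (λ A B → S + A + M * B) (orbit-closes u<) (orbit-digits u<) ⟩
    S + u + M * σ p u                     ∎)
    where
    open ≡-Reasoning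
    x : ℕ → ℕ
    x j = iter j shift u
    S = ∑< m x
    rearrange : ∀ S u T → (S + u) + T ≡ S + T + u
    rearrange = solve-∀

  split-at : ∀ t u → u ≡ p ^ t * (u div (p ^ t)) + u mod (p ^ t)
  split-at t u = trans (euclid u (p ^ t) ⦃ m^n≢0 p t ⦄)
    (sym (cong₂ (λ w v → p ^ t * w + v) (div≡/ u (p ^ t) ⦃ m^n≢0 p t ⦄) (mod≡% u (p ^ t) ⦃ m^n≢0 p t ⦄)))

  p^m-split : ∀ {t} → t ≤ m → p ^ m ≡ p ^ (m ∸ t) * p ^ t
  p^m-split {t} t≤m = trans (cong (p ^_) (sym (m∸n+n≡m t≤m))) (^-distribˡ-+-* p (m ∸ t) t)

  rotate-split : ∀ {t u} → t ≤ m → u < p ^ m → iter (m ∸ t) shift u ≡ p ^ (m ∸ t) * (u mod (p ^ t)) + u div (p ^ t)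
  rotate-split {t} {u} t≤m u< = rotate (m ∸ t) t (m∸n+n≡m t≤m) (split-at t u) w< v<
    where
    instance
      p^t≢0 : NonZero (p ^ t)
      p^t≢0 = m^n≢0 p t
    w< : u div (p ^ t) < p ^ (m ∸ t)
    w< = subst (_< p ^ (m ∸ t)) (sym (div≡/ u (p ^ t))) (m<n*o⇒m/o<n (subst (u <_) (p^m-split t≤m) u<))
    v< : u mod (p ^ t) < p ^ t
    v< = subst (_< p ^ t) (sym (mod≡% u (p ^ t))) (m%n<n u (p ^ t))

  low-digits-identity : ∀ {t u} → t ≤ m → u < p ^ m → p ^ t * iter (m ∸ t) shift u ≡ M * (u mod (p ^ t)) + u
  low-digits-identity {t} {u} t≤m u< = begin
    p ^ t * iter (m ∸ t) shift u                              ≡⟨ cong (p ^ t *_) (rotate-split t≤m u<) ⟩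
    p ^ t * (p ^ (m ∸ t) * (u mod (p ^ t)) + u div (p ^ t))        ≡⟨ digit-rotation (p ^ t) (p ^ (m ∸ t)) _ _ M M+1 ⟩
    M * (u mod (p ^ t)) + (p ^ t * (u div (p ^ t)) + u mod (p ^ t)) ≡⟨ cong (_+_ (M * (u mod (p ^ t)))) (sym (split-at t u)) ⟩
    M * (u mod (p ^ t)) + u                                     ∎
    where
    open ≡-Reasoning
    M+1 : suc M ≡ p ^ t * p ^ (m ∸ t)
    M+1 = trans suc-M (trans (p^m-split t≤m) (*-comm (p ^ (m ∸ t)) (p ^ t)))

  high-digits-identity : ∀ {t u} → t ≤ m → u < p ^ m → p ^ (m ∸ t) * u ≡ M * (u div (p ^ t)) + iter (m ∸ t) shift u
  high-digits-identity {t} {u} t≤m u< = begin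
    p ^ (m ∸ t) * u                                           ≡⟨ cong (p ^ (m ∸ t) *_) (split-at t u) ⟩
    p ^ (m ∸ t) * (p ^ t * (u div (p ^ t)) + u mod (p ^ t))        ≡⟨ digit-rotation (p ^ (m ∸ t)) (p ^ t) _ _ M (trans suc-M (p^m-split t≤m)) ⟩
    M * (u div (p ^ t)) + (p ^ (m ∸ t) * (u mod (p ^ t)) + u div (p ^ t)) ≡⟨ cong (_+_ (M * (u div (p ^ t)))) (sym (rotate-split t≤m u<)) ⟩
    M * (u div (p ^ t)) + iter (m ∸ t) shift u                  ∎
    where open ≡-Reasoning

  module Orbit {n r : ℕ} (D : Fin n → Fin r → ℕ) (U : Fin n → ℕ)
               (bounded : ∀ i → U i < p ^ m) (divisible : ∀ j → M ∣ lin D U j) where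

    orbit : ℕ → Fin n → ℕ
    orbit s = iter s (δ p m) U

    orbit-coord : ∀ s i → orbit s i ≡ iter s shift (U i)
    orbit-coord zero    i = refl
    orbit-coord (suc s) i = cong shift (orbit-coord s i)

    orbit-bounded : ∀ s i → orbit s i < p ^ m
    orbit-bounded s i = subst (_< p ^ m) (sym (orbit-coord s i)) (iter-bound s (bounded i))

    -- M divides every Σ_i δ_m^s(U)_i·d_i, so φ is defined exactly along the orbit:
    -- from (step), p·lin(δ^s U) = M·lin(top digits) + lin(δ^(s+1) U).
    orbit-divisible : ∀ s j → M ∣ lin D (orbit s) j
    orbit-divisible zero    j = divisible j
    orbit-divisible (suc s) j = ∣m+n∣m⇒∣n (subst (M ∣_) step (∣n⇒∣m*n p (orbit-divisible s j))) (m∣m*n _)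
      where
      step : p * lin D (orbit s) j ≡ M * lin D (λ i → lead (orbit s i)) j + lin D (orbit (suc s)) j
      step = lin-affine D j p M (orbit s) (λ i → lead (orbit s i)) (orbit (suc s)) (λ i → shift-step (orbit-bounded s i))

    orbit-φ : ∀ s j → lin D (orbit s) j ≡ φ p D m (orbit s) j * M
    orbit-φ s j = sym (div-exact ⦃ M≢0 ⦄ (orbit-divisible s j))

    digit-sum-formula : ∀ j → lin D (λ i → σ p (U i)) j ≡ (p ∸ 1) * ∑< m (λ s → φ p D m (orbit s) j)
    digit-sum-formula j = *-cancelʳ-≡ L ((p ∸ 1) * Φ) M ⦃ M≢0 ⦄ (begin
      L * M                             ≡⟨ *-comm L M ⟩
      M * L                             ≡⟨ sym (lin-scale D j M σU) ⟩
      lin D (λ i → M * σU i) j          ≡⟨ sym (lin-cong D j (λ i → orbit-sum (bounded i))) ⟩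
      lin D (λ i → (p ∸ 1) * S i) j     ≡⟨ lin-scale D j (p ∸ 1) S ⟩
      (p ∸ 1) * lin D S j               ≡⟨ cong ((p ∸ 1) *_) orbit-total ⟩
      (p ∸ 1) * (Φ * M)                 ≡⟨ sym (*-assoc (p ∸ 1) Φ M) ⟩
      (p ∸ 1) * Φ * M                   ∎)
      where
      open ≡-Reasoning
      σU S : Fin n → ℕ
      σU i = σ p (U i)
      S i = ∑< m (λ s → iter s shift (U i))
      L = lin D σU j
      Φ = ∑< m (λ s → φ p D m (orbit s) j)
      orbit-total : lin D S j ≡ Φ * M
      orbit-total = begin
        lin D S j                                        ≡⟨ lin-∑< D j (λ s i → iter s shift (U i)) m ⟩
        ∑< m (λ s → lin D (λ i → iter s shift (U i)) j)  ≡⟨ ∑<-cong m (λ s → trans (sym (lin-cong D j (orbit-coord s))) (orbit-φ s j)) ⟩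
        ∑< m (λ s → φ p D m (orbit s) j * M)             ≡⟨ ∑<-*ʳ m (λ s → φ p D m (orbit s) j) M ⟩
        Φ * M                                            ∎

    low-digits-formula : ∀ t → t ≤ m → ∀ j →
      + lin D (λ i → U i mod (p ^ t)) j ≡ + (p ^ t * φ p D m (orbit (m ∸ t)) j) - + φ p D m U j
    low-digits-formula t t≤m j = difference-formula (p ^ t) (φ p D m (orbit (m ∸ t)) j) (φ p D m U j) (lin D v j) M ⦃ M≢0 ⦄ (begin
      p ^ t * (φ p D m (orbit (m ∸ t)) j * M)           ≡⟨ cong (p ^ t *_) (sym (orbit-φ (m ∸ t) j)) ⟩
      p ^ t * lin D (orbit (m ∸ t)) j                    ≡⟨ lin-affine D j (p ^ t) M (orbit (m ∸ t)) v U per-coordinate ⟩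
      M * lin D v j + lin D U j                          ≡⟨ cong (_+_ (M * lin D v j)) (orbit-φ 0 j) ⟩
      M * lin D v j + φ p D m U j * M                    ∎)
      where
      open ≡-Reasoning
      v : Fin n → ℕ
      v i = U i mod (p ^ t)
      per-coordinate : ∀ i → p ^ t * orbit (m ∸ t) i ≡ M * v i + U i
      per-coordinate i = trans (cong (p ^ t *_) (orbit-coord (m ∸ t) i)) (low-digits-identity t≤m (bounded i))

    high-digits-formula : ∀ t → t ≤ m → ∀ j →
      + lin D (λ i → U i div (p ^ t)) j ≡ + (p ^ (m ∸ t) * φ p D m U j) - + φ p D m (orbit (m ∸ t)) j
    high-digits-formula t t≤m j = difference-formula (p ^ (m ∸ t)) (φ p D m U j) (φ p D m (orbit (m ∸ t)) j) (lin D w j) M ⦃ M≢0 ⦄ (begin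
      p ^ (m ∸ t) * (φ p D m U j * M)                    ≡⟨ cong (p ^ (m ∸ t) *_) (sym (orbit-φ 0 j)) ⟩
      p ^ (m ∸ t) * lin D U j                            ≡⟨ lin-affine D j (p ^ (m ∸ t)) M U w (orbit (m ∸ t)) per-coordinate ⟩
      M * lin D w j + lin D (orbit (m ∸ t)) j            ≡⟨ cong (_+_ (M * lin D w j)) (orbit-φ (m ∸ t) j) ⟩
      M * lin D w j + φ p D m (orbit (m ∸ t)) j * M      ∎)
      where
      open ≡-Reasoning
      w : Fin n → ℕ
      w i = U i div (p ^ t)
      per-coordinate : ∀ i → p ^ (m ∸ t) * U i ≡ M * w i + orbit (m ∸ t) i
      per-coordinate i = trans (high-digits-identity t≤m (bounded i)) (cong (_+_ (M * w i)) (sym (orbit-coord (m ∸ t) i)))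

-- The theorem: p prime gives p ≥ 2, and m ≥ 1.
mainTheorem14 : (p : ℕ) → Prime p → (n r : ℕ) → (D : Fin n → Fin r → ℕ)
    → 1 ≤ n
    → Injective _≡_ _≡_ D
    → (∀ i → ¬ (∀ j → D i j ≡ 0))
    → (∀ j → ∃ λ i → ¬ (D i j ≡ 0))
    → (m : ℕ) → 1 ≤ m
    → (U : Fin n → ℕ) → InE p D m U
    → (∀ j → lin D (λ i → σ p (U i)) j
               ≡ (p ∸ 1) * ∑< m (λ k → φ p D m (iter k (δ p m) U) j))
      × ((t : ℕ) → 1 ≤ t → t ≤ m ∸ 1 →
           (∀ j → + lin D (λ i → U i mod (p ^ t)) j
                    ≡ + (p ^ t * φ p D m (iter (m ∸ t) (δ p m) U) j) - + φ p D m U j)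
           × (∀ j → + lin D (λ i → U i div (p ^ t)) j
                    ≡ + (p ^ (m ∸ t) * φ p D m U j) - + φ p D m (iter (m ∸ t) (δ p m) U) j))
mainTheorem14 zero             p-prime = ⊥-elim (¬prime[0] p-prime)
mainTheorem14 (suc zero)       p-prime = ⊥-elim (¬prime[1] p-prime)
mainTheorem14 (suc (suc p′)) _ n r D _ _ _ _ zero    ()
mainTheorem14 (suc (suc p′)) _ n r D _ _ _ _ (suc k) _ U U∈E =
  digit-sum-formula , λ t _ t≤m-1 → low-digits-formula t (t≤m t≤m-1) , high-digits-formula t (t≤m t≤m-1)
  where
  open Shift p′ k
  open Orbit D U (InE.bounded U∈E) (InE.divisible U∈E)
  t≤m : ∀ {t} → t ≤ m ∸ 1 → t ≤ m
  t≤m t≤m-1 = ≤-trans t≤m-1 (m∸n≤m m 1)
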